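{- If $D$ is a reachable oriented graph with order $n$ and maximum out-degree $\Delta^+$, and $k$ is a positive integer with $k \leq \Delta^+$, then \[ F_k(D) \leq \frac{(\Delta^+ - k)n + k}{\Delta^+}, \] and this inequality is sharp (there exist reachable oriented graphs for which equality holds).
   Context: An oriented graph is a digraph obtained from a simple graph by giving each edge exactly one direction; if $(u,v)$ is an arc, $v$ is an out-neighbor of $u$. $D$ is reachable if there is a vertex $v$ such that every other vertex is reachable from $v$ by a directed path. Oriented $k$-forcing: starting from a nonempty set $S$ of colored vertices, repeatedly, any colored vertex having at most $k$ non-colored out-neighbors forces all of them to become colored (all forcings in a step simultaneous), until no change occurs; $S$ is a $k$-forcing set if all vertices end up colored. $F_k(D)$ is the minimum size of a $k$-forcing set of $D$. -}

module Defs where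

open import Data.Bool using (Bool; true; false; T; not; _∧_; _∨_)
open import Data.Nat using (ℕ; zero; suc; _≤_; _≤ᵇ_; _⊔_)
open import Data.Fin using (Fin)
open import Data.Fin.Subset using (Subset; ∣_∣; ⊤; Nonempty)
open import Data.Vec using (tabulate; lookup)
open import Data.List using (List; foldr; map; allFin)
open import Data.Bool.ListAction using (any)
open import Data.Product using (_×_; ∃)
open import Relation.Binary.PropositionalEquality using (_≡_)
open import Relation.Binary.Construct.Closure.ReflexiveTransitive using (Star)

Digraph : ℕ → Set
Digraph n = Fin n → Fin n → Bool

Arc : ∀ {n} → Digraph n → Fin n → Fin n → Set
Arc A u v = T (A u v)

Oriented : ∀ {n} → Digraph n → Set
Oriented A = (∀ u → ¬T (A u u)) × (∀ u v → T (A u v) → ¬T (A v u))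
  where
  open import Relation.Nullary using (¬_)
  ¬T : Bool → Set
  ¬T b = ¬ T b

Reachable : ∀ {n} → Digraph n → Set
Reachable {n} A = ∃ λ (r : Fin n) → ∀ v → Star (Arc A) r v

outNbrs : ∀ {n} → Digraph n → Fin n → Subset n
outNbrs A u = tabulate (A u)

outDeg : ∀ {n} → Digraph n → Fin n → ℕ
outDeg A u = ∣ outNbrs A u ∣

maxOutDeg : ∀ {n} → Digraph n → ℕ
maxOutDeg {n} A = foldr _⊔_ 0 (map (outDeg A) (allFin n))

uncoloredOut : ∀ {n} → Digraph n → Subset n → Fin n → ℕ
uncoloredOut A S u = ∣ tabulate (λ w → A u w ∧ not (lookup S w)) ∣

forceStep : ∀ {n} → ℕ → Digraph n → Subset n → Subset n
forceStep {n} k A S = tabulate λ v →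
  lookup S v ∨ any (λ u → lookup S u ∧ A u v ∧ (uncoloredOut A S u ≤ᵇ k)) (allFin n)

iter : ∀ {a} {X : Set a} → ℕ → (X → X) → X → X
iter zero    f x = x
iter (suc m) f x = f (iter m f x)

-- Final coloured set: the process is monotone and adds at least one vertex
-- per non-final step, so it stabilises after at most n steps.
closure : ∀ {n} → ℕ → Digraph n → Subset n → Subset n
closure {n} k A S = iter n (forceStep k A) S

IsForcingSet : ∀ {n} → ℕ → Digraph n → Subset n → Set
IsForcingSet k A S = Nonempty S × closure k A S ≡ ⊤

IsForcingNumber : ∀ {n} → ℕ → Digraph n → ℕ → Set
IsForcingNumber {n} k A m =
  (∃ λ (S : Subset n) → IsForcingSet k A S × ∣ S ∣ ≡ m) ×
  (∀ (S : Subset n) → IsForcingSet k A S → m ≤ ∣ S ∣)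

-- Grow a coloured set C from a seed set S ⊆ C, starting from S = C = {r},
-- where r reaches every vertex. While C is not everything, reachability gives
-- a coloured v with u ≥ 1 uncoloured out-neighbours. If u ≤ k, v forces them
-- all; otherwise put u − k of them into S and let v force the remaining k.
-- Either way C grows by u and S by (u ∸ k), and since k ≤ Δ⁺ and u ≤ Δ⁺ we
-- have Δ⁺ (u ∸ k) + k u ≤ Δ⁺ u, which preserves the invariant
-- Δ⁺ |S| + k |C| ≤ Δ⁺ |C| + k. At C = V this is the bound. The star K(1,k),
-- oriented away from its centre, is forced by its centre and attains equality.
module Submission where

open import Defs
open import Data.Nat using (ℕ; _≤_; _+_; _*_; _∸_)
open import Data.Product using (_×_; Σ)
open import Relation.Binary.PropositionalEquality using (_≡_)

open import Data.Bool using (Bool; true; false; T; not; _∧_)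
open import Data.Bool.Properties using (T-≡; T-∧; T-∨; T-not-≡; ¬-not)
open import Data.Empty using (⊥; ⊥-elim)
open import Data.Fin using (Fin; zero; suc)
open import Data.Fin.Properties using (all?; ¬∀⟶∃¬)
open import Data.Fin.Subset
  using (Subset; ∣_∣; ⊤; _∈_; _∉_; _⊆_; _∪_; _∩_; _─_; ⁅_⁆; Empty; inside; outside)
open import Data.Fin.Subset.Properties
  using ( _∈?_; ∈⊤; ⊆⊤; ⊆-antisym; ∣⊤∣≡n; ∣p∣≤n; p⊆q⇒∣p∣≤∣q∣; drop-∷-Empty
        ; x∈⁅x⁆; x∈⁅y⁆⇒x≡y; ∣⁅x⁆∣≡1; p⊆p∪q; q⊆p∪q; x∈p∪q⁻; ∣p∣≤∣p∪q∣
        ; x∈p∩q⁻; x∈p∧x∉q⇒x∈p─q)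
open import Data.List using (allFin)
open import Data.List.Properties using (foldr-forcesᵇ; foldr-preservesᵇ)
import Data.List.Relation.Unary.All as All
open import Data.List.Relation.Unary.All.Properties using (map⁺; tabulate⁺)
open import Data.List.Relation.Unary.Any using (satisfied)
open import Data.List.Relation.Unary.Any.Properties using (any⁺; any⁻)
open import Data.List.Membership.Propositional using (lose)
open import Data.List.Membership.Propositional.Properties using (∈-allFin; ∈-map⁺)
open import Data.Nat using (zero; suc; z≤n; s≤s; _<_)
open import Data.Nat.Properties
open import Data.Nat.Solver using (module +-*-Solver)
open import Data.Product using (_,_; proj₁; proj₂; ∃; ∃₂)
open import Data.Sum using (_⊎_; inj₁; inj₂)
open import Data.Unit using (tt)
open import Data.Vec using ([]; _∷_; lookup; tabulate; here; there)
open import Data.Vec.Properties using (lookup∘tabulate; []=⇒lookup; lookup⇒[]=)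
open import Function using (_∘_; Equivalence)
open import Relation.Binary.Construct.Closure.ReflexiveTransitive using (Star; ε; _◅_)
open import Relation.Binary.PropositionalEquality using (refl; sym; trans; cong; subst)
open import Relation.Nullary using (yes; no)

open Equivalence using (to; from)

private
  variable
    n t t′ : ℕ
    p S S′ : Subset n
    x u v w : Fin n

m∸[m∸n]≤n : ∀ m n → m ∸ (m ∸ n) ≤ n
m∸[m∸n]≤n m n with ≤-total n m
... | inj₁ n≤m = ≤-reflexive (m∸[m∸n]≡n n≤m)
... | inj₂ m≤n = ≤-trans (m∸n≤m m (m ∸ n)) m≤n

m*[o∸n]+n*o≤m*o : ∀ m n o → n ≤ m → o ≤ m → m * (o ∸ n) + n * o ≤ m * o
m*[o∸n]+n*o≤m*o m n o n≤m o≤m with ≤-total n o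
... | inj₁ n≤o = begin
  m * (o ∸ n) + n * o ≤⟨ +-monoʳ-≤ (m * (o ∸ n)) (*-monoʳ-≤ n o≤m) ⟩
  m * (o ∸ n) + n * m ≡⟨ cong (m * (o ∸ n) +_) (*-comm n m) ⟩
  m * (o ∸ n) + m * n ≡⟨ *-distribˡ-+ m (o ∸ n) n ⟨
  m * (o ∸ n + n)     ≡⟨ cong (m *_) (m∸n+n≡m n≤o) ⟩
  m * o               ∎
  where open ≤-Reasoning
... | inj₂ o≤n = begin
  m * (o ∸ n) + n * o ≡⟨ cong (λ z → m * z + n * o) (m≤n⇒m∸n≡0 o≤n) ⟩
  m * 0 + n * o       ≡⟨ cong (_+ n * o) (*-zeroʳ m) ⟩
  n * o               ≤⟨ *-monoˡ-≤ o n≤m ⟩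
  m * o               ∎
  where open ≤-Reasoning

budget-step : ∀ Δ k s s′ c u → k ≤ Δ → u ≤ Δ → s′ ≤ s + (u ∸ k) →
              Δ * s + k * c ≤ Δ * c + k →
              Δ * s′ + k * (c + u) ≤ Δ * (c + u) + k
budget-step Δ k s s′ c u k≤Δ u≤Δ s′≤ budget = begin
  Δ * s′ + k * (c + u)                        ≤⟨ +-monoˡ-≤ (k * (c + u)) (*-monoʳ-≤ Δ s′≤) ⟩
  Δ * (s + e) + k * (c + u)                   ≡⟨ regroup Δ k s e c u ⟩
  (Δ * s + k * c) + (Δ * e + k * u)           ≤⟨ +-mono-≤ budget (m*[o∸n]+n*o≤m*o Δ k u k≤Δ u≤Δ) ⟩
  (Δ * c + k) + Δ * u                         ≡⟨ collect Δ k c u ⟩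
  Δ * (c + u) + k                             ∎
  where
  open ≤-Reasoning
  open +-*-Solver
  e = u ∸ k
  regroup : ∀ Δ k s e c u → Δ * (s + e) + k * (c + u) ≡ (Δ * s + k * c) + (Δ * e + k * u)
  regroup = solve 6 (λ Δ k s e c u → Δ :* (s :+ e) :+ k :* (c :+ u)
                                   := (Δ :* s :+ k :* c) :+ (Δ :* e :+ k :* u)) refl
  collect : ∀ Δ k c u → (Δ * c + k) + Δ * u ≡ Δ * (c + u) + k
  collect = solve 4 (λ Δ k c u → (Δ :* c :+ k) :+ Δ :* u := Δ :* (c :+ u) :+ k) refl

bound-rearrange : ∀ Δ k s n F → k ≤ Δ → F ≤ s → Δ * s + k * n ≤ Δ * n + k →
                  Δ * F ≤ (Δ ∸ k) * n + k
bound-rearrange Δ k s n F k≤Δ F≤s budget = subst (Δ * F ≤_) rhs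
  (m+n≤o⇒m≤o∸n (Δ * F) (≤-trans (+-monoˡ-≤ (k * n) (*-monoʳ-≤ Δ F≤s)) budget))
  where
  rhs : Δ * n + k ∸ k * n ≡ (Δ ∸ k) * n + k
  rhs = trans (+-∸-comm k (*-monoˡ-≤ n k≤Δ)) (cong (_+ k) (sym (*-distribʳ-∸ n Δ k)))

∈⇒T : x ∈ p → T (lookup p x)
∈⇒T x∈p = from T-≡ ([]=⇒lookup x∈p)

T⇒∈ : T (lookup p x) → x ∈ p
T⇒∈ {p = p} {x = x} px = lookup⇒[]= x p (to T-≡ px)

∉⇒T-not : x ∉ p → T (not (lookup p x))
∉⇒T-not x∉p = from T-not-≡ (¬-not (x∉p ∘ T⇒∈ ∘ from T-≡))

∈-tabulate⁺ : ∀ {f : Fin n → Bool} → T (f x) → x ∈ tabulate f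
∈-tabulate⁺ {x = x} {f = f} fx = T⇒∈ (subst T (sym (lookup∘tabulate f x)) fx)

∈-tabulate⁻ : ∀ {f : Fin n → Bool} → x ∈ tabulate f → T (f x)
∈-tabulate⁻ {x = x} {f = f} x∈ = subst T (lookup∘tabulate f x) (∈⇒T x∈)

nonempty⇒1≤∣p∣ : x ∈ p → 1 ≤ ∣ p ∣
nonempty⇒1≤∣p∣ {x = x} x∈p = subst (_≤ _) (∣⁅x⁆∣≡1 x)
  (p⊆q⇒∣p∣≤∣q∣ (λ y∈⁅x⁆ → subst (_∈ _) (sym (x∈⁅y⁆⇒x≡y x y∈⁅x⁆)) x∈p))

∣p∪q∣≡∣p∣+∣q∣ : ∀ (p q : Subset n) → Empty (p ∩ q) → ∣ p ∪ q ∣ ≡ ∣ p ∣ + ∣ q ∣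
∣p∪q∣≡∣p∣+∣q∣ []            []            _ = refl
∣p∪q∣≡∣p∣+∣q∣ (inside ∷ p)  (inside ∷ q)  e = ⊥-elim (e (zero , here))
∣p∪q∣≡∣p∣+∣q∣ (inside ∷ p)  (outside ∷ q) e = cong suc (∣p∪q∣≡∣p∣+∣q∣ p q (drop-∷-Empty e))
∣p∪q∣≡∣p∣+∣q∣ (outside ∷ p) (inside ∷ q)  e =
  trans (cong suc (∣p∪q∣≡∣p∣+∣q∣ p q (drop-∷-Empty e))) (sym (+-suc ∣ p ∣ ∣ q ∣))
∣p∪q∣≡∣p∣+∣q∣ (outside ∷ p) (outside ∷ q) e = ∣p∪q∣≡∣p∣+∣q∣ p q (drop-∷-Empty e)

prefix : ℕ → Subset n → Subset n
prefix d       []            = []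
prefix d       (outside ∷ p) = outside ∷ prefix d p
prefix zero    (inside ∷ p)  = outside ∷ prefix zero p
prefix (suc d) (inside ∷ p)  = inside ∷ prefix d p

prefix-⊆ : ∀ d (p : Subset n) → prefix d p ⊆ p
prefix-⊆ d       (outside ∷ p) (there x∈) = there (prefix-⊆ d p x∈)
prefix-⊆ zero    (inside ∷ p)  (there x∈) = there (prefix-⊆ zero p x∈)
prefix-⊆ (suc d) (inside ∷ p)  here       = here
prefix-⊆ (suc d) (inside ∷ p)  (there x∈) = there (prefix-⊆ d p x∈)

∣prefix∣≤ : ∀ d (p : Subset n) → ∣ prefix d p ∣ ≤ d
∣prefix∣≤ d       []            = z≤n
∣prefix∣≤ d       (outside ∷ p) = ∣prefix∣≤ d p
∣prefix∣≤ zero    (inside ∷ p)  = ∣prefix∣≤ zero p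
∣prefix∣≤ (suc d) (inside ∷ p)  = s≤s (∣prefix∣≤ d p)

∣p─prefix∣ : ∀ d (p : Subset n) → ∣ p ─ prefix d p ∣ ≡ ∣ p ∣ ∸ d
∣p─prefix∣ d       []            = sym (0∸n≡0 d)
∣p─prefix∣ d       (outside ∷ p) = ∣p─prefix∣ d p
∣p─prefix∣ zero    (inside ∷ p)  = cong suc (∣p─prefix∣ zero p)
∣p─prefix∣ (suc d) (inside ∷ p)  = ∣p─prefix∣ d p

Star-crosses : ∀ {R : Fin n → Fin n → Set} → x ∈ p → w ∉ p → Star R x w →
               ∃₂ λ u v → u ∈ p × R u v × v ∉ p
Star-crosses x∈p w∉p ε = ⊥-elim (w∉p x∈p)
Star-crosses {p = p} x∈p w∉p (_◅_ {j = y} xRy path) with y ∈? p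
... | yes y∈p = Star-crosses y∈p w∉p path
... | no  y∉p = _ , _ , x∈p , xRy , y∉p

outDeg≤maxOutDeg : ∀ (A : Digraph n) v → outDeg A v ≤ maxOutDeg A
outDeg≤maxOutDeg A v = All.lookup
  (foldr-forcesᵇ (λ a b ab≤ → m⊔n≤o⇒m≤o a b ab≤ , m⊔n≤o⇒n≤o a b ab≤) 0 _ ≤-refl)
  (∈-map⁺ (outDeg A) (∈-allFin v))

maxOutDeg≤ : ∀ (A : Digraph n) {b} → (∀ v → outDeg A v ≤ b) → maxOutDeg A ≤ b
maxOutDeg≤ A {b} out≤b = foldr-preservesᵇ {P = _≤ b} ⊔-lub z≤n (map⁺ (tabulate⁺ out≤b))

module _ (f : Subset n → Subset n) where

  iter-inflationary : (∀ X → X ⊆ f X) → t ≤ t′ → iter t f S ⊆ iter t′ f S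
  iter-inflationary infl t≤t′ with m≤n⇒m<n∨m≡n t≤t′
  ... | inj₂ refl = λ x∈ → x∈
  ... | inj₁ (s≤s t≤t″) = infl _ ∘ iter-inflationary infl t≤t″

  iter-mono : (∀ {X Y} → X ⊆ Y → f X ⊆ f Y) → ∀ t → S ⊆ S′ → iter t f S ⊆ iter t f S′
  iter-mono mono zero    S⊆S′ = S⊆S′
  iter-mono mono (suc t) S⊆S′ = mono (iter-mono mono t S⊆S′)

module Forcing (k : ℕ) (A : Digraph n) where

  uncoloredNbrs : Subset n → Fin n → Subset n
  uncoloredNbrs S u = tabulate (λ w → A u w ∧ not (lookup S w))

  uncoloredNbrs⁺ : T (A u w) → w ∉ S → w ∈ uncoloredNbrs S u
  uncoloredNbrs⁺ uw w∉S = ∈-tabulate⁺ (from T-∧ (uw , ∉⇒T-not w∉S))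

  uncoloredNbrs⁻ : w ∈ uncoloredNbrs S u → T (A u w) × w ∉ S
  uncoloredNbrs⁻ {S = S} w∈ with to T-∧ (∈-tabulate⁻ w∈)
  ... | uw , w∉S = uw , λ w∈S → subst (T ∘ not) (to T-≡ (∈⇒T w∈S)) w∉S

  uncoloredNbrs-anti : S ⊆ S′ → uncoloredNbrs S′ u ⊆ uncoloredNbrs S u
  uncoloredNbrs-anti S⊆S′ w∈ with uncoloredNbrs⁻ w∈
  ... | uw , w∉S′ = uncoloredNbrs⁺ uw (w∉S′ ∘ S⊆S′)

  uncoloredOut≤maxOutDeg : ∀ S u → uncoloredOut A S u ≤ maxOutDeg A
  uncoloredOut≤maxOutDeg S u = ≤-trans
    (p⊆q⇒∣p∣≤∣q∣ (∈-tabulate⁺ ∘ proj₁ ∘ uncoloredNbrs⁻ {S = S}))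
    (outDeg≤maxOutDeg A u)

  forceStep-inflationary : ∀ S → S ⊆ forceStep k A S
  forceStep-inflationary S v∈S = ∈-tabulate⁺ (from T-∨ (inj₁ (∈⇒T v∈S)))

  forceStep-forces : u ∈ S → uncoloredOut A S u ≤ k → T (A u v) → v ∈ forceStep k A S
  forceStep-forces {u = u} u∈S few uv = ∈-tabulate⁺ (from T-∨ (inj₂
    (any⁺ _ (lose (∈-allFin u) (from T-∧ (∈⇒T u∈S , from T-∧ (uv , ≤⇒≤ᵇ few)))))))

  forceStep⁻ : v ∈ forceStep k A S →
               v ∈ S ⊎ ∃ λ u → u ∈ S × T (A u v) × uncoloredOut A S u ≤ k
  forceStep⁻ {S = S} v∈ with to T-∨ (∈-tabulate⁻ v∈)
  ... | inj₁ v∈S = inj₁ (T⇒∈ v∈S)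
  ... | inj₂ forced with satisfied (any⁻ _ (allFin _) forced)
  ...   | u , conds with to T-∧ conds
  ...     | u∈S , rest with to T-∧ rest
  ...       | uv , few = inj₂ (u , T⇒∈ u∈S , uv , ≤ᵇ⇒≤ _ k few)

  forceStep-mono : S ⊆ S′ → forceStep k A S ⊆ forceStep k A S′
  forceStep-mono {S′ = S′} S⊆S′ v∈ with forceStep⁻ v∈
  ... | inj₁ v∈S = forceStep-inflationary S′ (S⊆S′ v∈S)
  ... | inj₂ (u , u∈S , uv , few) = forceStep-forces (S⊆S′ u∈S)
          (≤-trans (p⊆q⇒∣p∣≤∣q∣ (uncoloredNbrs-anti S⊆S′)) few) uv

  uncoloredNbrs-forced : ∀ t {C W : Subset n} → C ⊆ iter t (forceStep k A) S → W ⊆ S →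
    v ∈ C → ∣ uncoloredNbrs C v ─ W ∣ ≤ k → uncoloredNbrs C v ⊆ iter (suc t) (forceStep k A) S
  uncoloredNbrs-forced {S = S} t {C} {W} C⊆X W⊆S v∈C few x∈U =
    forceStep-forces (C⊆X v∈C) (≤-trans (p⊆q⇒∣p∣≤∣q∣ left⊆U─W) few)
      (proj₁ (uncoloredNbrs⁻ {S = C} x∈U))
    where
    W⊆X : W ⊆ iter t (forceStep k A) S
    W⊆X = iter-inflationary (forceStep k A) {t′ = t} forceStep-inflationary z≤n ∘ W⊆S
    left⊆U─W : uncoloredNbrs (iter t (forceStep k A) S) v ⊆ uncoloredNbrs C v ─ W
    left⊆U─W y∈ = x∈p∧x∉q⇒x∈p─q (uncoloredNbrs-anti C⊆X y∈) (proj₂ (uncoloredNbrs⁻ y∈) ∘ W⊆X)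

-- The upper bound

module Greedy (k : ℕ) (A : Digraph n) (k≤Δ : k ≤ maxOutDeg A)
              (r : Fin n) (reach : ∀ v → Star (Arc A) r v) where

  open Forcing k A

  Δ : ℕ
  Δ = maxOutDeg A

  force : Subset n → Subset n
  force = forceStep k A

  -- Every step of the construction colours a new vertex, so ∣ colored ∣
  -- forcing rounds suffice; once colored = ⊤ these are the n rounds of closure.
  record Stage : Set where
    field
      seeds colored  : Subset n
      seeds⊆colored  : seeds ⊆ colored
      colored⊆forced : colored ⊆ iter ∣ colored ∣ force seeds
      root∈seeds     : r ∈ seeds
      budget         : Δ * ∣ seeds ∣ + k * ∣ colored ∣ ≤ Δ * ∣ colored ∣ + k

  open Stage

  initial : Stage
  initial = record
    { seeds          = ⁅ r ⁆
    ; colored        = ⁅ r ⁆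
    ; seeds⊆colored  = λ x∈ → x∈
    ; colored⊆forced = iter-inflationary force {t′ = ∣ ⁅ r ⁆ ∣} forceStep-inflationary z≤n
    ; root∈seeds     = x∈⁅x⁆ r
    ; budget         = subst (λ c → Δ * c + k * c ≤ Δ * c + k) (sym (∣⁅x⁆∣≡1 r))
                         (≤-reflexive (cong (Δ * 1 +_) (*-identityʳ k)))
    }

  -- The uncoloured out-neighbours U of v all become coloured one step later
  -- once W ⊆ U, of size ∣ U ∣ ∸ k, is added to the seeds: v is then left with
  -- at most k uncoloured out-neighbours.
  module Extension (st : Stage) {v w} (v∈C : v ∈ colored st) (vw : T (A v w))
                   (w∉C : w ∉ colored st) where
    C U W S⁺ C⁺ : Subset n
    C = colored st
    U = uncoloredNbrs C v
    W = prefix (∣ U ∣ ∸ k) U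
    S⁺ = seeds st ∪ W
    C⁺ = C ∪ U

    U-fresh : x ∈ U → x ∉ C
    U-fresh = proj₂ ∘ uncoloredNbrs⁻ {S = C}

    disjoint : ∀ {p q} → p ⊆ C → q ⊆ U → Empty (p ∩ q)
    disjoint p⊆C q⊆U (_ , x∈) with x∈p∩q⁻ _ _ x∈
    ... | x∈p , x∈q = U-fresh (q⊆U x∈q) (p⊆C x∈p)

    ∣C⁺∣ : ∣ C⁺ ∣ ≡ ∣ C ∣ + ∣ U ∣
    ∣C⁺∣ = ∣p∪q∣≡∣p∣+∣q∣ C U (disjoint (λ x∈ → x∈) (λ x∈ → x∈))

    growth : ∣ C ∣ < ∣ C⁺ ∣
    growth = subst (∣ C ∣ <_) (sym ∣C⁺∣) (subst (_≤ ∣ C ∣ + ∣ U ∣) (+-comm ∣ C ∣ 1)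
               (+-monoʳ-≤ ∣ C ∣ (nonempty⇒1≤∣p∣ (uncoloredNbrs⁺ vw w∉C))))

    ∣S⁺∣≤ : ∣ S⁺ ∣ ≤ ∣ seeds st ∣ + (∣ U ∣ ∸ k)
    ∣S⁺∣≤ = ≤-trans
      (≤-reflexive (∣p∪q∣≡∣p∣+∣q∣ (seeds st) W
        (disjoint (seeds⊆colored st) (prefix-⊆ (∣ U ∣ ∸ k) U))))
      (+-monoʳ-≤ ∣ seeds st ∣ (∣prefix∣≤ (∣ U ∣ ∸ k) U))

    C⊆forced : C ⊆ iter ∣ C ∣ force S⁺
    C⊆forced = iter-mono force forceStep-mono ∣ C ∣ (p⊆p∪q W) ∘ colored⊆forced st

    U⊆forced : U ⊆ iter (suc ∣ C ∣) force S⁺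
    U⊆forced = uncoloredNbrs-forced ∣ C ∣ C⊆forced (q⊆p∪q (seeds st) W) v∈C
      (subst (_≤ k) (sym (∣p─prefix∣ (∣ U ∣ ∸ k) U)) (m∸[m∸n]≤n (∣ U ∣) k))

    C⁺⊆forced : C⁺ ⊆ iter ∣ C⁺ ∣ force S⁺
    C⁺⊆forced x∈ with x∈p∪q⁻ C U x∈
    ... | inj₁ x∈C = iter-inflationary force forceStep-inflationary (∣p∣≤∣p∪q∣ C U) (C⊆forced x∈C)
    ... | inj₂ x∈U = iter-inflationary force forceStep-inflationary growth (U⊆forced x∈U)

    S⁺⊆C⁺ : S⁺ ⊆ C⁺
    S⁺⊆C⁺ x∈ with x∈p∪q⁻ (seeds st) W x∈
    ... | inj₁ x∈S = p⊆p∪q U (seeds⊆colored st x∈S)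
    ... | inj₂ x∈W = q⊆p∪q C U (prefix-⊆ (∣ U ∣ ∸ k) U x∈W)

    extended : Stage
    extended = record
      { seeds          = S⁺
      ; colored        = C⁺
      ; seeds⊆colored  = S⁺⊆C⁺
      ; colored⊆forced = C⁺⊆forced
      ; root∈seeds     = p⊆p∪q W (root∈seeds st)
      ; budget         = subst (λ c → Δ * ∣ S⁺ ∣ + k * c ≤ Δ * c + k) (sym ∣C⁺∣)
          (budget-step Δ k (∣ seeds st ∣) (∣ S⁺ ∣) (∣ C ∣) (∣ U ∣) k≤Δ
             (uncoloredOut≤maxOutDeg C v) ∣S⁺∣≤ (budget st))
      }

  extend : (st : Stage) → v ∈ colored st → T (A v w) → w ∉ colored st →
           Σ Stage λ st′ → ∣ colored st ∣ < ∣ colored st′ ∣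
  extend st v∈C vw w∉C = extended , growth
    where open Extension st v∈C vw w∉C

  grow : (st : Stage) → w ∉ colored st → Σ Stage λ st′ → ∣ colored st ∣ < ∣ colored st′ ∣
  grow {w = w} st w∉C
    with Star-crosses {p = colored st} (seeds⊆colored st (root∈seeds st)) w∉C (reach w)
  ... | v , v′ , v∈C , vv′ , v′∉C = extend st v∈C vv′ v′∉C

  saturate : ∀ m (st : Stage) → n ≤ m + ∣ colored st ∣ → Σ Stage λ st → colored st ≡ ⊤
  saturate m st n≤ with all? (_∈? colored st)
  ... | yes all∈ = st , ⊆-antisym ⊆⊤ (λ {x} _ → all∈ x)
  ... | no ¬all∈ with ¬∀⟶∃¬ n _ (_∈? colored st) ¬all∈
  ...   | w , w∉C with grow st w∉C | m
  ...     | st′ , growth | zero  = ⊥-elim (<⇒≱ growth (≤-trans (∣p∣≤n (colored st′)) n≤))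
  ...     | st′ , growth | suc m = saturate m st′
            (≤-trans n≤ (≤-trans (≤-reflexive (sym (+-suc m _))) (+-monoʳ-≤ m growth)))

  saturated : Σ Stage λ st → colored st ≡ ⊤
  saturated = saturate n initial (m≤m+n n _)

forcingSet-bound : ∀ k (A : Digraph n) → Reachable A → k ≤ maxOutDeg A →
  ∃ λ S → IsForcingSet k A S × maxOutDeg A * ∣ S ∣ + k * n ≤ maxOutDeg A * n + k
forcingSet-bound {n} k A (r , reach) k≤Δ =
  seeds st , ((r , root∈seeds st) , closure≡⊤) ,
  subst (λ c → maxOutDeg A * ∣ seeds st ∣ + k * c ≤ maxOutDeg A * c + k) ∣C∣≡n (budget st)
  where
  open Greedy k A k≤Δ r reach
  open Stage
  st : Stage
  st = proj₁ saturated

  C≡⊤ : colored st ≡ ⊤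
  C≡⊤ = proj₂ saturated

  ∣C∣≡n : ∣ colored st ∣ ≡ n
  ∣C∣≡n = trans (cong ∣_∣ C≡⊤) (∣⊤∣≡n n)

  closure≡⊤ : closure k A (seeds st) ≡ ⊤
  closure≡⊤ = ⊆-antisym ⊆⊤ λ {x} _ →
    subst (λ t → x ∈ iter t force (seeds st)) ∣C∣≡n
      (colored⊆forced st (subst (x ∈_) (sym C≡⊤) ∈⊤))

-- Sharpness: the out-star

star : ∀ k → Digraph (suc k)
star k zero (suc _) = true
star k _    _       = false

star-oriented : ∀ k → Oriented (star k)
star-oriented k = irreflexive , antisymmetric
  where
  irreflexive : ∀ u → T (star k u u) → ⊥
  irreflexive zero    ()
  irreflexive (suc u) ()
  antisymmetric : ∀ u v → T (star k u v) → T (star k v u) → ⊥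
  antisymmetric zero    zero    ()
  antisymmetric zero    (suc v) _ ()
  antisymmetric (suc u) v       ()

star-reachable : ∀ k → Reachable (star k)
star-reachable k = zero , λ { zero → ε ; (suc v) → tt ◅ ε }

maxOutDeg-star : ∀ k → maxOutDeg (star k) ≡ k
maxOutDeg-star k = ≤-antisym (maxOutDeg≤ (star k) outDeg≤k)
  (≤-trans centre (outDeg≤maxOutDeg (star k) zero))
  where
  outDeg≤k : ∀ u → outDeg (star k) u ≤ k
  outDeg≤k zero    = ∣p∣≤n (tabulate (star k zero ∘ suc))
  outDeg≤k (suc u) = ∣p∣≤n (tabulate (star k (suc u) ∘ suc))
  centre : k ≤ outDeg (star k) zero
  centre = subst (_≤ outDeg (star k) zero) (∣⊤∣≡n k)
    (p⊆q⇒∣p∣≤∣q∣ {p = ⊤} {q = tabulate (star k zero ∘ suc)} λ _ → ∈-tabulate⁺ tt)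

star-forcingNumber : ∀ k → IsForcingNumber k (star k) 1
star-forcingNumber k = (⁅ zero ⁆ , ((zero , x∈⁅x⁆ zero) , closure≡⊤) , ∣⁅x⁆∣≡1 {n = suc k} zero) ,
                       λ S ((x , x∈S) , _) → nonempty⇒1≤∣p∣ x∈S
  where
  open Forcing k (star k)
  centre-forces : ∀ v → v ∈ forceStep k (star k) ⁅ zero ⁆
  centre-forces zero    = forceStep-inflationary ⁅ zero ⁆ (x∈⁅x⁆ zero)
  centre-forces (suc v) = forceStep-forces (x∈⁅x⁆ zero)
    (subst (uncoloredOut (star k) ⁅ zero ⁆ zero ≤_) (maxOutDeg-star k)
      (uncoloredOut≤maxOutDeg ⁅ zero ⁆ zero)) tt
  closure≡⊤ : closure k (star k) ⁅ zero ⁆ ≡ ⊤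
  closure≡⊤ = ⊆-antisym ⊆⊤ λ {v} _ →
    iter-inflationary (forceStep k (star k)) {t = 1} {t′ = suc k} {S = ⁅ zero ⁆}
      forceStep-inflationary (s≤s z≤n) (centre-forces v)

forcingNumber-upper-bound : (n : ℕ) (D : Digraph n) (k F : ℕ) →
  Oriented D → Reachable D → 1 ≤ k → k ≤ maxOutDeg D →
  IsForcingNumber k D F →
  maxOutDeg D * F ≤ (maxOutDeg D ∸ k) * n + k
forcingNumber-upper-bound n D k F _ reachable _ k≤Δ (_ , minimal)
  with forcingSet-bound k D reachable k≤Δ
... | S , forcing , budget =
  bound-rearrange (maxOutDeg D) k ∣ S ∣ n F k≤Δ (minimal S forcing) budget

forcingNumber-sharp : (k : ℕ) → 1 ≤ k →
  Σ ℕ λ n → Σ (Digraph n) λ D → Σ ℕ λ F →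
    Oriented D × Reachable D × k ≤ maxOutDeg D ×
    IsForcingNumber k D F ×
    maxOutDeg D * F ≡ (maxOutDeg D ∸ k) * n + k
forcingNumber-sharp k _ = suc k , star k , 1 , star-oriented k , star-reachable k ,
  ≤-reflexive (sym (maxOutDeg-star k)) , star-forcingNumber k , equality
  where
  equality : maxOutDeg (star k) * 1 ≡ (maxOutDeg (star k) ∸ k) * suc k + k
  equality rewrite maxOutDeg-star k | n∸n≡0 k = *-identityʳ k

theorem2p9 :
    ((n : ℕ) (D : Digraph n) (k F : ℕ) →
      Oriented D → Reachable D → 1 ≤ k → k ≤ maxOutDeg D →
      IsForcingNumber k D F →
      maxOutDeg D * F ≤ (maxOutDeg D ∸ k) * n + k)
    ×
    ((k : ℕ) → 1 ≤ k →
      Σ ℕ λ n → Σ (Digraph n) λ D → Σ ℕ λ F →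
        Oriented D × Reachable D × k ≤ maxOutDeg D ×
        IsForcingNumber k D F ×
        maxOutDeg D * F ≡ (maxOutDeg D ∸ k) * n + k)
theorem2p9 = forcingNumber-upper-bound , forcingNumber-sharp
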